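{- Let $B$ be a base hierarchy and $C$ a good successor for $B$, with ${\uparrow}={\uparrow}^C_B$ and $\Uparrow^b_c=(\Uparrow^b_c)^C_B$. Let $n\in\mathbb N$ and $b={\rm Base}_B(n)$. Write $n=ba+r$ with $r<b$ (not necessarily a $b$-decomposition), and let $c\geq{\uparrow} b$. Then: (1) $\Uparrow^b_c n=\Uparrow^b_c(ba)+{\uparrow} r$; (2) ${\uparrow} n={\uparrow}(ba)+{\uparrow} r$; (3) ${\rm Base}_C({\uparrow} n)={\rm Base}_C({\uparrow}(ba))$.
   Context: For $b\geq 2$ and $0<n\in\mathbb N$, the $b$-decomposition of $n$ is the unique expression $n=b^ea+r$ with $0<a<b$, $r<b^e$; write $n=_b b^ea+r$. For $B\subseteq\mathbb N$, $S_B(n)$ is the least $b\in B$ with $b>n$ ($\infty$ if none); every positive integer divides $\infty$. A base hierarchy is a nonempty $B\subseteq\mathbb N\setminus\{0,1\}$ with $b\mid S_B(b)$ for all $b\in B$. Upper base: ${\rm Base}_B(n)=\max\{b\in B:b\leq\max\{n,\min B\}\}$. Upgrade: for base hierarchies $B,C$ with $\min B\leq\min C$, ${\uparrow} n={\uparrow}^C_B n\in\mathbb N\cup\{\infty\}$ is defined recursively (expressions involving $\infty$ equal $\infty$): ${\uparrow} n=n$ if $n<\min B$; otherwise with $b={\rm Base}_B(n)$, ${\uparrow} n=\Uparrow^b_c n$ for the least $c\in C$ with ${\uparrow}(n-1)<\Uparrow^b_c n<S_C(c)$, or $\infty$ if none. Here, for any $b\geq 2$ and $c,m\in\mathbb N$,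 the deep base change is $\Uparrow^b_c m={\uparrow} m$ if $m<b$ and $\Uparrow^b_c m=c^{\Uparrow^b_c e}\cdot{\uparrow}a+\Uparrow^b_c r$ if $m=_b b^ea+r$. $C$ is a good successor of $B$ if both are base hierarchies, $\min B\leq\min C$, ${\uparrow}^C_B n<\infty$ for all $n$, and whenever $\min B<n+1\in B$ there is no multiple of ${\rm Base}_C({\uparrow}^C_B n)$ in $({\uparrow}^C_B n,S_C({\uparrow}^C_B n))$. -}

module Defs where

open import Data.Nat using (ℕ; zero; suc; _+_; _*_; _∸_; _^_; _≤_; _<_; _⊔_)
open import Data.Nat.Divisibility using (_∣_)
open import Data.Maybe using (Maybe; just; nothing)
open import Data.Product using (Σ; _×_; _,_)
open import Data.Unit using (⊤)
open import Relation.Nullary using (¬_)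
open import Relation.Binary.PropositionalEquality using (_≡_)

Subset : Set₁
Subset = ℕ → Set

-- ℕ ∪ {∞} : nothing = ∞.
ℕ∞ : Set
ℕ∞ = Maybe ℕ

_<∞_ : ℕ → ℕ∞ → Set
n <∞ just x = n < x
n <∞ nothing = ⊤

_∣∞_ : ℕ → ℕ∞ → Set
d ∣∞ just x = d ∣ x
d ∣∞ nothing = ⊤

IsMin : Subset → ℕ → Set
IsMin B m = B m × (∀ x → B x → m ≤ x)

IsSucc : Subset → ℕ → ℕ∞ → Set
IsSucc B n (just s) = B s × n < s × (∀ x → B x → n < x → s ≤ x)
IsSucc B n nothing = ∀ x → B x → x ≤ n

BaseHierarchy : Subset → Set
BaseHierarchy B =
  Σ ℕ B
  × (∀ b → B b → 2 ≤ b)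
  × (∀ b → B b → ∀ s → IsSucc B b s → b ∣∞ s)

IsBase : Subset → ℕ → ℕ → Set
IsBase B n b = Σ ℕ λ m → IsMin B m
  × (B b × b ≤ n ⊔ m × (∀ x → B x → x ≤ n ⊔ m → x ≤ b))

-- Deep base change ⇑^b_c, relative to a (total) upgrade function u = ↑ :
-- DBC u b c m v  means  ⇑^b_c m = v.
data DBC (u : ℕ → ℕ) (b c : ℕ) : ℕ → ℕ → Set where
  small  : ∀ {m} → m < b → DBC u b c m (u m)
  decomp : ∀ {m e a r v₁ v₂} → b ≤ m → m ≡ b ^ e * a + r →
           0 < a → a < b → r < b ^ e →
           DBC u b c e v₁ → DBC u b c r v₂ →
           DBC u b c m (c ^ v₁ * u a + v₂)

-- c is an admissible candidate with value v in the definition of ↑ n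
-- (with b = Base_B(n)):  c ∈ C,  v = ⇑^b_c n,  ↑(n-1) < v < S_C(c).
Cand : Subset → (ℕ → ℕ) → ℕ → ℕ → ℕ → ℕ → Set
Cand C u b n c v = C c × DBC u b c n v × u (n ∸ 1) < v
  × Σ ℕ∞ (λ s → IsSucc C c s × v <∞ s)

-- u is the upgrade ↑^C_B and takes only finite values:
-- ↑ n = n if n < min B; otherwise ↑ n = ⇑^b_c n for the least c ∈ C that is
-- an admissible candidate.
IsUpgrade : Subset → Subset → (ℕ → ℕ) → Set
IsUpgrade B C u = ∀ n → ∀ m → IsMin B m →
    (n < m → u n ≡ n)
  × (m ≤ n → ∀ b → IsBase B n b →
       Σ ℕ λ c → Cand C u b n c (u n)
               × (∀ c' → c' < c → ∀ v' → ¬ Cand C u b n c' v'))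

GoodSuccessor : Subset → Subset → (ℕ → ℕ) → Set
GoodSuccessor B C u =
  BaseHierarchy B × BaseHierarchy C
  × (∀ mB mC → IsMin B mB → IsMin C mC → mB ≤ mC)
  × IsUpgrade B C u
  × (∀ n → (∀ m → IsMin B m → m < suc n) → B (suc n) →
       ∀ d s → IsBase C (u n) d → IsSucc C (u n) s →
       ∀ k → u n < k → k <∞ s → ¬ (d ∣ k))

-- Write m = b·a. As b ∣ m, the rest in the b-decomposition of m is a multiple of b, so adding
-- r < b to it neither reaches the next power of b nor touches the leading digit: ⇑^b_c(m + r)
-- = ⇑^b_c m + ↑r. For ↑, let γ be the base chosen for ↑m. It stays the least admissible base
-- at every m + t with t ≤ r: the value ↑m + ↑t stays below S_C(γ), because γ divides both ↑m
-- and S_C(γ) while ↑t < ↑b ≤ γ; and a smaller base c' is never admissible, since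
-- S_C(c') ≤ γ ≤ ↑(m + t − 1). Induction on t gives ↑(m + t) = ↑m + ↑t, and γ is the upper
-- base of every value in [γ, S_C(γ)), which contains ↑m and ↑n. (For a = 0 everything lies
-- below min B, where ↑ is the identity.)
module Submission where

open import Defs
open import Data.Nat
open import Data.Nat.Properties
open import Data.Nat.Divisibility
open import Data.Nat.DivMod
open import Data.Nat.Induction using (<-rec)
open import Data.Product
open import Data.Sum using (inj₁; inj₂)
open import Data.Maybe using (just; nothing)
open import Data.Unit using (tt)
open import Function using (case_of_)
open import Relation.Nullary
open import Relation.Nullary.Negation using (¬¬-map)
open import Relation.Nullary.Decidable using (¬¬-excluded-middle; decidable-stable)
open import Relation.Binary.PropositionalEquality
open import Relation.Binary.Definitions using (tri<; tri≈; tri>)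

¬¬-IsMin : ∀ {P : ℕ → Set} {x} → P x → ¬ ¬ Σ ℕ (IsMin P)
¬¬-IsMin {P} {x} = <-rec (λ y → P y → ¬ ¬ Σ ℕ (IsMin P)) least x
  where
  least : ∀ x → (∀ {y} → y < x → P y → ¬ ¬ Σ ℕ (IsMin P)) → P x → ¬ ¬ Σ ℕ (IsMin P)
  least x rec px ¬min = ¬¬-excluded-middle {A = Σ ℕ λ y → y < x × P y} λ where
    (yes (y , y<x , py)) → rec y<x py ¬min
    (no ¬below) → ¬min (x , px , λ y py → ≮⇒≥ λ y<x → ¬below (y , y<x , py))

¬¬-greatest : ∀ {P : ℕ → Set} N {x} → P x → x ≤ N →
  ¬ ¬ Σ ℕ λ g → P g × g ≤ N × (∀ y → P y → y ≤ N → y ≤ g)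
¬¬-greatest zero px z≤n ¬max = ¬max (0 , px , z≤n , λ _ _ y≤0 → y≤0)
¬¬-greatest {P} (suc N) px x≤1+N ¬max = ¬¬-excluded-middle λ where
    (yes p[1+N]) → ¬max (suc N , p[1+N] , ≤-refl , λ _ _ y≤1+N → y≤1+N)
    (no ¬p[1+N]) → ¬¬-greatest N px (≤N ¬p[1+N] px x≤1+N) λ (g , pg , g≤N , max) →
      ¬max (g , pg , m≤n⇒m≤1+n g≤N , λ y py y≤1+N → max y py (≤N ¬p[1+N] py y≤1+N))
  where
  ≤N : ∀ {y} → ¬ P (suc N) → P y → y ≤ suc N → y ≤ N
  ≤N ¬p[1+N] py y≤1+N with m≤n⇒m<n∨m≡n y≤1+N
  ... | inj₁ y<1+N = m<1+n⇒m≤n y<1+N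
  ... | inj₂ refl = contradiction py ¬p[1+N]

¬¬-IsBase : ∀ {B m} n → IsMin B m → ¬ ¬ Σ ℕ (IsBase B n)
¬¬-IsBase {m = m} n isMin = ¬¬-map (λ (g , Bg , g≤ , max) → g , m , isMin , Bg , g≤ , max)
  (¬¬-greatest (n ⊔ m) (proj₁ isMin) (m≤n⊔m n m))

[p*a+r]/p≡a : ∀ p a {r} .{{_ : NonZero p}} → r < p → (p * a + r) / p ≡ a
[p*a+r]/p≡a p a {r} r<p = begin
  (p * a + r) / p   ≡⟨ +-distrib-/-∣ˡ r (m∣m*n a) ⟩
  p * a / p + r / p ≡⟨ cong₂ _+_ (trans (cong (_/ p) (*-comm p a)) (m*n/n≡m a p)) (m<n⇒m/n≡0 r<p) ⟩
  a + 0             ≡⟨ +-identityʳ a ⟩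
  a                 ∎
  where open ≡-Reasoning

[p*a+r]%p≡r : ∀ p a {r} .{{_ : NonZero p}} → r < p → (p * a + r) % p ≡ r
[p*a+r]%p≡r p a {r} r<p = trans (%-remove-+ˡ r (m∣m*n a)) (m<n⇒m%n≡m r<p)

m∣m^n : ∀ m {n} → 0 < n → m ∣ m ^ n
m∣m^n m {suc n} _ = m∣m*n (m ^ n)

m≤m^n : ∀ {m n} → 0 < m → 0 < n → m ≤ m ^ n
m≤m^n {m} {suc n} 0<m _ = m≤m*n m (m ^ n)
  where instance _ = >-nonZero 0<m
                 _ = m^n≢0 m n

<-multiples⇒+< : ∀ {d x y t} → d ∣ x → d ∣ y → x < y → t < d → x + t < y
<-multiples⇒+< {d} {t = t} (divides p refl) (divides q refl) x<y t<d = begin-strict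
  p * d + t ≡⟨ +-comm (p * d) t ⟩
  t + p * d <⟨ +-monoˡ-< (p * d) t<d ⟩
  suc p * d ≤⟨ *-monoˡ-≤ d (*-cancelʳ-< d p q x<y) ⟩
  q * d     ∎
  where open ≤-Reasoning

IsDecomposition : (b m e a r : ℕ) → Set
IsDecomposition b m e a r = m ≡ b ^ e * a + r × 0 < a × a < b × r < b ^ e

module Positional {b : ℕ} (1<b : 1 < b) where

  instance
    b-nonZero : NonZero b
    b-nonZero = >-nonZero (<-trans z<s 1<b)

  n<b^n : ∀ n → n < b ^ n
  n<b^n zero = s≤s z≤n
  n<b^n (suc n) = ≤-<-trans (n<b^n n) (^-monoʳ-< b 1<b (n<1+n n))

  decomposition-bounds : ∀ {m e a r} → IsDecomposition b m e a r → b ^ e ≤ m × m < b ^ suc e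
  decomposition-bounds {e = e} {a} {r} (refl , 0<a , a<b , r<b^e) =
      ≤-trans (m≤m*n (b ^ e) a) (m≤m+n _ r)
    , (begin-strict
        b ^ e * a + r   <⟨ +-monoʳ-< (b ^ e * a) r<b^e ⟩
        b ^ e * a + b ^ e ≡⟨ trans (+-comm _ (b ^ e)) (sym (*-suc (b ^ e) a)) ⟩
        b ^ e * suc a   ≤⟨ *-monoʳ-≤ (b ^ e) a<b ⟩
        b ^ e * b       ≡⟨ *-comm (b ^ e) b ⟩
        b ^ suc e       ∎)
    where instance _ = >-nonZero 0<a
          open ≤-Reasoning

  exponent-≤ : ∀ {m e e'} → b ^ e ≤ m → m < b ^ suc e' → e ≤ e'
  exponent-≤ {e = e} {e'} b^e≤m m<b^[1+e'] = ≮⇒≥ λ e'<e →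
    <-irrefl refl (<-≤-trans m<b^[1+e'] (≤-trans (^-monoʳ-≤ b e'<e) b^e≤m))

  decomposition-unique : ∀ {m e a r e' a' r'} →
    IsDecomposition b m e a r → IsDecomposition b m e' a' r' → e ≡ e' × a ≡ a' × r ≡ r'
  decomposition-unique {e = e} {a} {e' = e'} {a'} d@(refl , _ , _ , r<b^e) d'@(m≡ , _ , _ , r'<b^e')
    with decomposition-bounds {e = e} d | decomposition-bounds {e = e'} d'
  ... | lo , hi | lo' , hi' with ≤-antisym {e} {e'} (exponent-≤ lo hi') (exponent-≤ lo' hi)
  ... | refl =
      refl
    , trans (sym ([p*a+r]/p≡a (b ^ e) a r<b^e)) (trans (cong (_/ b ^ e) m≡) ([p*a+r]/p≡a (b ^ e) a' r'<b^e'))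
    , trans (sym ([p*a+r]%p≡r (b ^ e) a r<b^e)) (trans (cong (_% b ^ e) m≡) ([p*a+r]%p≡r (b ^ e) a' r'<b^e'))
    where instance _ = m^n≢0 b e

  exponent-exists : ∀ {m} → 0 < m → ∀ k → m < b ^ k → Σ ℕ λ e → b ^ e ≤ m × m < b ^ suc e
  exponent-exists 0<m zero m<1 = contradiction 0<m (<⇒≱ m<1)
  exponent-exists {m} 0<m (suc k) m<b^[1+k] with m <? b ^ k
  ... | yes m<b^k = exponent-exists 0<m k m<b^k
  ... | no m≮b^k = k , ≮⇒≥ m≮b^k , m<b^[1+k]

  decomposition-exists : ∀ {m} → 0 < m → Σ[ e ∈ ℕ ] Σ[ a ∈ ℕ ] Σ[ r ∈ ℕ ] IsDecomposition b m e a r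
  decomposition-exists {m} 0<m with exponent-exists 0<m m (n<b^n m)
  ... | e , b^e≤m , m<b^[1+e] =
      e , m / b ^ e , m % b ^ e
    , trans (m≡m%n+[m/n]*n m (b ^ e))
        (trans (+-comm (m % b ^ e) _) (cong (_+ m % b ^ e) (*-comm (m / b ^ e) (b ^ e))))
    , m≥n⇒m/n>0 b^e≤m
    , m<n*o⇒m/o<n m<b^[1+e]
    , m%n<n m (b ^ e)
    where instance _ = m^n≢0 b e

  exponent-pos : ∀ {m e a r} → b ≤ m → IsDecomposition b m e a r → 0 < e
  exponent-pos {e = zero} b≤m d =
    contradiction (subst (_ <_) (*-identityʳ b) (proj₂ (decomposition-bounds {e = zero} d))) (≤⇒≯ b≤m)
  exponent-pos {e = suc e} _ _ = z<s

  b∣rest : ∀ {m e a r} → b ∣ m → 0 < e → IsDecomposition b m e a r → b ∣ r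
  b∣rest {e = e} {a} b∣m 0<e (refl , _) = ∣m+n∣m⇒∣n b∣m (∣m⇒∣m*n a (m∣m^n b 0<e))

module DeepBaseChange (u : ℕ → ℕ) {b : ℕ} (1<b : 1 < b) (c : ℕ) where
  open Positional 1<b

  DBC-functional : ∀ {m v v'} → DBC u b c m v → DBC u b c m v' → v ≡ v'
  DBC-functional (small _) (small _) = refl
  DBC-functional (small m<b) (decomp b≤m _ _ _ _ _ _) = contradiction b≤m (<⇒≱ m<b)
  DBC-functional (decomp b≤m _ _ _ _ _ _) (small m<b) = contradiction b≤m (<⇒≱ m<b)
  DBC-functional (decomp {e = e} {a} {r} _ m≡ 0<a a<b r<b^e De Dr)
                 (decomp {e = e'} {a'} {r'} _ m≡' 0<a' a<b' r'<b^e' De' Dr')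
    with decomposition-unique {e = e} {a} {r} {e'} {a'} {r'} (m≡ , 0<a , a<b , r<b^e) (m≡' , 0<a' , a<b' , r'<b^e')
  ... | refl , refl , refl =
    cong₂ (λ v₁ v₂ → c ^ v₁ * u _ + v₂) (DBC-functional De De') (DBC-functional Dr Dr')

  DBC-exists : ∀ m → Σ ℕ (DBC u b c m)
  DBC-exists = <-rec (λ m → Σ ℕ (DBC u b c m)) step
    where
    step : ∀ m → (∀ {k} → k < m → Σ ℕ (DBC u b c k)) → Σ ℕ (DBC u b c m)
    step m rec with m <? b
    ... | yes m<b = u m , small m<b
    ... | no m≮b with decomposition-exists (<-≤-trans (<-trans z<s 1<b) (≮⇒≥ m≮b))
    ... | e , a , r , d@(m≡ , 0<a , a<b , r<b^e) =
        _ , decomp (≮⇒≥ m≮b) m≡ 0<a a<b r<b^e (proj₂ (rec (<-≤-trans (n<b^n e) b^e≤m)))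
                                               (proj₂ (rec (<-≤-trans r<b^e b^e≤m)))
      where b^e≤m = proj₁ (decomposition-bounds {e = e} d)

  DBC-base : u 0 ≡ 0 → u 1 ≡ 1 → DBC u b c b c
  DBC-base u0≡0 u1≡1 = subst (DBC u b c b) c^1*1+0≡c
    (decomp ≤-refl b≡b^1*1+0 z<s 1<b (m^n>0 b 1) (small 1<b) (small (<-trans z<s 1<b)))
    where
    b≡b^1*1+0 : b ≡ b ^ 1 * 1 + 0
    b≡b^1*1+0 = sym (trans (+-identityʳ _) (trans (*-identityʳ _) (*-identityʳ b)))
    c^1*1+0≡c : c ^ u 1 * u 1 + u 0 ≡ c
    c^1*1+0≡c rewrite u1≡1 | u0≡0 = trans (+-identityʳ _) (trans (*-identityʳ _) (*-identityʳ c))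

  DBC-+ : u 0 ≡ 0 → ∀ {m v t} → b ∣ m → t < b → DBC u b c m v → DBC u b c (m + t) (v + u t)
  DBC-+ u0≡0 {t = t} _ t<b (small {zero} _) = subst (DBC u b c t) (cong (_+ u t) (sym u0≡0)) (small t<b)
  DBC-+ u0≡0 b∣m _ (small {suc m} m<b) = contradiction (∣⇒≤ b∣m) (<⇒≱ m<b)
  DBC-+ u0≡0 {t = t} b∣m t<b (decomp {m} {e} {a} {r} {v₁} {v₂} b≤m m≡ 0<a a<b r<b^e De Dr) =
    subst (DBC u b c (m + t)) (sym (+-assoc (c ^ v₁ * u a) v₂ (u t)))
      (decomp (≤-trans b≤m (m≤m+n m t)) (trans (cong (_+ t) m≡) (+-assoc (b ^ e * a) r t))
              0<a a<b r+t<b^e De (DBC-+ u0≡0 b∣r t<b Dr))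
    where
    d = m≡ , 0<a , a<b , r<b^e
    0<e = exponent-pos {e = e} {a} {r} b≤m d
    b∣r = b∣rest {e = e} {a} {r} b∣m 0<e d
    r+t<b^e = <-multiples⇒+< b∣r (m∣m^n b 0<e) r<b^e t<b

  DBC-split : u 0 ≡ 0 → ∀ {n a r} → r < b → n ≡ b * a + r →
    Σ ℕ λ v → DBC u b c (b * a) v × DBC u b c n (v + u r)
  DBC-split u0≡0 {a = a} r<b refl with DBC-exists (b * a)
  ... | v , Dba = v , Dba , DBC-+ u0≡0 (m∣m*n a) r<b Dba

  module _ (k≤u[k] : ∀ k → k ≤ u k) (0<c : 0 < c) where
    private instance _ = >-nonZero 0<c

    DBC-pos : ∀ {m v} → 0 < m → DBC u b c m v → 0 < v
    DBC-pos {m} 0<m (small _) = ≤-trans 0<m (k≤u[k] m)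
    DBC-pos _ (decomp {a = a} {v₁ = v₁} {v₂} _ _ 0<a _ _ _ _) =
      ≤-trans (*-mono-≤ (m^n>0 c v₁) (≤-trans 0<a (k≤u[k] a))) (m≤m+n _ v₂)

    exponent-image-pos : ∀ {m e a r v₁} → b ≤ m → IsDecomposition b m e a r → DBC u b c e v₁ → 0 < v₁
    exponent-image-pos {e = e} {a} {r} b≤m d De = DBC-pos (exponent-pos {e = e} {a} {r} b≤m d) De

    DBC-≥ : ∀ {m v} → b ≤ m → DBC u b c m v → c ≤ v
    DBC-≥ b≤m (small m<b) = contradiction b≤m (<⇒≱ m<b)
    DBC-≥ b≤m (decomp {a = a} {v₁ = v₁} {v₂} _ m≡ 0<a a<b r<b^e De _) =
      ≤-trans (m≤m^n 0<c (exponent-image-pos b≤m (m≡ , 0<a , a<b , r<b^e) De))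
        (≤-trans (m≤m*n (c ^ v₁) (u a)) (m≤m+n _ v₂))
      where instance _ = >-nonZero (≤-trans 0<a (k≤u[k] a))

    DBC-∣ : u 0 ≡ 0 → ∀ {m v} → b ∣ m → DBC u b c m v → c ∣ v
    DBC-∣ u0≡0 _ (small {zero} _) = subst (c ∣_) (sym u0≡0) (c ∣0)
    DBC-∣ u0≡0 b∣m (small {suc m} m<b) = contradiction (∣⇒≤ b∣m) (<⇒≱ m<b)
    DBC-∣ u0≡0 b∣m (decomp {e = e} {a} {r} b≤m m≡ 0<a a<b r<b^e De Dr) =
      ∣m∣n⇒∣m+n (∣m⇒∣m*n (u a) (m∣m^n c (exponent-image-pos {e = e} {a} {r} b≤m d De)))
                (DBC-∣ u0≡0 (b∣rest {e = e} {a} {r} b∣m (exponent-pos {e = e} {a} {r} b≤m d) d) Dr)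
      where d = m≡ , 0<a , a<b , r<b^e

below-successor : ∀ {C : Subset} {γ v z} {s : ℕ∞} → IsSucc C γ s → v <∞ s → C z → z ≤ v → z ≤ γ
below-successor {s = nothing} maximal _ Cz _ = maximal _ Cz
below-successor {γ = γ} {z = z} {just s} (_ , _ , least) v<s Cz z≤v with z ≤? γ
... | yes z≤γ = z≤γ
... | no z≰γ = contradiction (least z Cz (≰⇒> z≰γ)) (<⇒≱ (≤-<-trans z≤v v<s))

<∞-multiples⇒+<∞ : ∀ {d x t} {s : ℕ∞} → d ∣ x → d ∣∞ s → x <∞ s → t < d → (x + t) <∞ s
<∞-multiples⇒+<∞ {s = just s} d∣x d∣s x<s t<d = <-multiples⇒+< d∣x d∣s x<s t<d
<∞-multiples⇒+<∞ {s = nothing} _ _ _ _ = tt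

IsBase-below-min : ∀ {C : Subset} {m y} → IsMin C m → y ≤ m → IsBase C y m
IsBase-below-min {m = m} isMin y≤m =
  m , isMin , proj₁ isMin , m≤n⊔m _ m , λ x _ x≤y⊔m → subst (x ≤_) (m≤n⇒m⊔n≡n y≤m) x≤y⊔m

IsBase-below-successor : ∀ {C : Subset} {m γ y} {s : ℕ∞} → IsMin C m → C γ → IsSucc C γ s →
  γ ≤ y → y <∞ s → IsBase C y γ
IsBase-below-successor {m = m} isMin Cγ succ γ≤y y<s =
  m , isMin , Cγ , ≤-trans γ≤y (m≤m⊔n _ m) ,
  λ x Cx x≤y⊔m →
    below-successor succ y<s Cx (subst (x ≤_) (m≥n⇒m⊔n≡m (≤-trans (proj₂ isMin _ Cγ) γ≤y)) x≤y⊔m)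

IsBase-between : ∀ {B : Subset} {n b x} → IsBase B n b → b ≤ x → x ≤ n → IsBase B x b
IsBase-between (m , isMin , Bb , _ , maximal) b≤x x≤n =
  m , isMin , Bb , ≤-trans b≤x (m≤m⊔n _ m) ,
  λ y By y≤x⊔m → maximal y By (≤-trans y≤x⊔m (⊔-monoˡ-≤ m x≤n))

no-smaller-candidate : ∀ {C : Subset} {u : ℕ → ℕ} {b n γ c v} →
  C γ → c < γ → γ ≤ u (n ∸ 1) → ¬ Cand C u b n c v
no-smaller-candidate Cγ c<γ γ≤u[n-1] (_ , _ , u[n-1]<v , _ , succ , v<s) =
  <⇒≱ c<γ (below-successor succ v<s Cγ (≤-trans γ≤u[n-1] (<⇒≤ u[n-1]<v)))

UpgradeSplits : Subset → (ℕ → ℕ) → (n m r : ℕ) → Set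
UpgradeSplits C u n m r = (u n ≡ u m + u r) × (Σ ℕ λ d → IsBase C (u n) d × IsBase C (u m) d)

module Upgrade {B C : Subset} {u : ℕ → ℕ} (hB : BaseHierarchy B) (hC : BaseHierarchy C)
  (minB≤minC : ∀ mB mC → IsMin B mB → IsMin C mC → mB ≤ mC) (upgrade : IsUpgrade B C u)
  {mB : ℕ} (isMinB : IsMin B mB) where

  1<B : ∀ {b} → B b → 1 < b
  1<B = proj₁ (proj₂ hB) _

  1<C : ∀ {c} → C c → 1 < c
  1<C = proj₁ (proj₂ hC) _

  1<mB : 1 < mB
  1<mB = 1<B (proj₁ isMinB)

  u-below-min : ∀ {k} → k < mB → u k ≡ k
  u-below-min {k} = proj₁ (upgrade k mB isMinB)

  u0≡0 : u 0 ≡ 0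
  u0≡0 = u-below-min (<-trans z<s 1<mB)

  u1≡1 : u 1 ≡ 1
  u1≡1 = u-below-min 1<mB

  chosen : ∀ {n b} → mB ≤ n → IsBase B n b →
    Σ ℕ λ c → Cand C u b n c (u n) × (∀ c' → c' < c → ∀ v' → ¬ Cand C u b n c' v')
  chosen {n} {b} mB≤n = proj₂ (upgrade n mB isMinB) mB≤n b

  -- Base_B(1 + k) exists only classically, but the goal is decidable.
  u-step : ∀ k → u k < u (suc k)
  u-step k with suc k <? mB
  ... | yes 1+k<mB =
    subst₂ _<_ (sym (u-below-min (<-trans (n<1+n k) 1+k<mB))) (sym (u-below-min 1+k<mB)) (n<1+n k)
  ... | no 1+k≮mB = decidable-stable (u k <? u (suc k)) (¬¬-map step (¬¬-IsBase (suc k) isMinB))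
    where
    step : Σ ℕ (IsBase B (suc k)) → u k < u (suc k)
    step (_ , isBase) with chosen (≮⇒≥ 1+k≮mB) isBase
    ... | _ , (_ , _ , u[k]<u[1+k] , _) , _ = u[k]<u[1+k]

  u-strictMono : ∀ {i j} → i < j → u i < u j
  u-strictMono {i} {suc j} i<1+j with m<1+n⇒m<n∨m≡n i<1+j
  ... | inj₁ i<j = <-trans (u-strictMono i<j) (u-step j)
  ... | inj₂ refl = u-step i

  u-mono : ∀ {i j} → i ≤ j → u i ≤ u j
  u-mono i≤j with m≤n⇒m<n∨m≡n i≤j
  ... | inj₁ i<j = <⇒≤ (u-strictMono i<j)
  ... | inj₂ refl = ≤-refl

  k≤u[k] : ∀ k → k ≤ u k
  k≤u[k] zero = z≤n
  k≤u[k] (suc k) = ≤-trans (s≤s (k≤u[k] k)) (u-step k)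

  IsBase-of-B : ∀ {b} → B b → IsBase B b b
  IsBase-of-B {b} Bb = mB , isMinB , Bb , m≤m⊔n b mB ,
    λ x _ x≤b⊔mB → subst (x ≤_) (m≥n⇒m⊔n≡m (proj₂ isMinB b Bb)) x≤b⊔mB

  u-base : ∀ {b} → B b → C (u b)
  u-base {b} Bb with chosen (proj₂ isMinB b Bb) (IsBase-of-B Bb)
  ... | c , (Cc , Db , _) , _ = subst C (DBC-functional (DBC-base u0≡0 u1≡1) Db) Cc
    where open DeepBaseChange u (1<B Bb) c

  u-by-candidate : ∀ {n b γ w} → mB ≤ n → IsBase B n b → Cand C u b n γ w → γ ≤ u (n ∸ 1) → u n ≡ w
  u-by-candidate {γ = γ} {w} mB≤n isBase candγ@(Cγ , Dw , _) γ≤u[n-1] with chosen mB≤n isBase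
  ... | c , cand@(_ , Dn , _) , minimal with <-cmp c γ
  ... | tri< c<γ _ _ = contradiction cand (no-smaller-candidate Cγ c<γ γ≤u[n-1])
  ... | tri> _ _ γ<c = contradiction candγ (minimal γ γ<c w)
  ... | tri≈ _ refl _ = DBC-functional Dn Dw
    where open DeepBaseChange u (1<B (proj₁ (proj₂ (proj₂ isBase)))) c

  candidate-at-min : ∀ {x mC s} → IsMin C mC → C x → IsSucc C x (just s) → Cand C u mB mB x x
  candidate-at-min {x} {mC} {s} isMinC Cx succ@(_ , x<s , _) =
    Cx , DBC-base u0≡0 u1≡1 , u[mB-1]<x , just s , succ , x<s
    where
    open DeepBaseChange u 1<mB x
    mB-1<mB : mB ∸ 1 < mB
    mB-1<mB = ∸-monoʳ-< z<s (<⇒≤ 1<mB)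
    u[mB-1]<x : u (mB ∸ 1) < x
    u[mB-1]<x = subst (_< x) (sym (u-below-min mB-1<mB))
      (<-≤-trans mB-1<mB (≤-trans (minB≤minC mB mC isMinB isMinC) (proj₂ isMinC x Cx)))

  -- The base c₀ chosen for ↑ mB is least in C: a smaller x ∈ C would be a candidate there.
  min-C : Σ ℕ (IsMin C)
  min-C with chosen ≤-refl (IsBase-of-B (proj₁ isMinB))
  ... | c₀ , (Cc₀ , _) , minimal = c₀ , Cc₀ , λ x Cx →
    decidable-stable (c₀ ≤? x) λ c₀≰x →
      ¬¬-IsMin Cx λ (_ , isMinC) →
      ¬¬-IsMin {P = λ y → C y × x < y} (Cc₀ , ≰⇒> c₀≰x) λ (_ , (Cs , x<s) , least) →
      minimal x (≰⇒> c₀≰x) x (candidate-at-min isMinC Cx (Cs , x<s , λ y Cy x<y → least y (Cy , x<y)))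

  module Block {n b m γ : ℕ} {s : ℕ∞} (n-base : IsBase B n b) (b≤m : b ≤ m) (b∣m : b ∣ m) (m≤n : m ≤ n)
    (Cγ : C γ) (Dm : DBC u b γ m (u m)) (succ : IsSucc C γ s) (u[m]<s : u m <∞ s) where

    private
      Bb = proj₁ (proj₂ (proj₂ n-base))
      open DeepBaseChange u (1<B Bb) γ

    γ≤u[m] : γ ≤ u m
    γ≤u[m] = DBC-≥ k≤u[k] (<-trans z<s (1<C Cγ)) b≤m Dm

    u[b]≤γ : u b ≤ γ
    u[b]≤γ = below-successor succ u[m]<s (u-base Bb) (u-mono b≤m)

    u[m]+u[t]<s : ∀ {t} → t < b → (u m + u t) <∞ s
    u[m]+u[t]<s t<b = <∞-multiples⇒+<∞ (DBC-∣ k≤u[k] (<-trans z<s (1<C Cγ)) u0≡0 b∣m Dm)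
      (proj₂ (proj₂ hC) γ Cγ s succ) u[m]<s (<-≤-trans (u-strictMono t<b) u[b]≤γ)

    u-additive : ∀ t → t < b → m + t ≤ n → u (m + t) ≡ u m + u t
    u-additive zero _ _ =
      trans (cong u (+-identityʳ m)) (sym (trans (cong (u m +_) u0≡0) (+-identityʳ (u m))))
    u-additive (suc t) 1+t<b m+1+t≤n =
      u-by-candidate (≤-trans (proj₂ isMinB b Bb) b≤x) (IsBase-between n-base b≤x m+1+t≤n)
        (Cγ , DBC-+ u0≡0 b∣m 1+t<b Dm , u[x-1]<w , s , succ , u[m]+u[t]<s 1+t<b)
        (subst (λ k → γ ≤ u k) (sym x-1≡m+t) (≤-trans γ≤u[m] (u-mono (m≤m+n m t))))
      where
      b≤x = ≤-trans b≤m (m≤m+n m (suc t))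
      x-1≡m+t : m + suc t ∸ 1 ≡ m + t
      x-1≡m+t = cong (_∸ 1) (+-suc m t)
      u[x-1]<w : u (m + suc t ∸ 1) < u m + u (suc t)
      u[x-1]<w = begin-strict
        u (m + suc t ∸ 1) ≡⟨ cong u x-1≡m+t ⟩
        u (m + t)         ≡⟨ u-additive t (<-trans (n<1+n t) 1+t<b)
                                          (≤-trans (+-monoʳ-≤ m (n≤1+n t)) m+1+t≤n) ⟩
        u m + u t         <⟨ +-monoʳ-< (u m) (u-step t) ⟩
        u m + u (suc t)   ∎
        where open ≤-Reasoning

    u-split : ∀ {r} → r < b → n ≡ m + r → UpgradeSplits C u n m r
    u-split {r} r<b n≡m+r =
        u[n]≡u[m]+u[r]
      , γ
      , IsBase-below-successor (proj₂ min-C) Cγ succ (≤-trans γ≤u[m] (u-mono m≤n))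
          (subst (_<∞ s) (sym u[n]≡u[m]+u[r]) (u[m]+u[t]<s r<b))
      , IsBase-below-successor (proj₂ min-C) Cγ succ γ≤u[m] u[m]<s
      where
      u[n]≡u[m]+u[r] : u n ≡ u m + u r
      u[n]≡u[m]+u[r] = trans (cong u n≡m+r) (u-additive r r<b (≤-reflexive (sym n≡m+r)))

  below-base⇒below-min : ∀ {n b} → IsBase B n b → n < b → n < mB
  below-base⇒below-min {b = b} (m , isMin , _ , b≤n⊔m , _) n<b = ≰⇒> λ mB≤n →
    <⇒≱ n<b (subst (b ≤_) (m≥n⇒m⊔n≡m (≤-trans (proj₂ isMin mB (proj₁ isMinB)) mB≤n)) b≤n⊔m)

  IsBase-C-below-minB : ∀ {y} → y ≤ mB → IsBase C y (proj₁ min-C)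
  IsBase-C-below-minB y≤mB =
    IsBase-below-min (proj₂ min-C) (≤-trans y≤mB (minB≤minC _ _ isMinB (proj₂ min-C)))

  u-split-below-min : ∀ {n b r} → IsBase B n b → r < b → n ≡ b * 0 + r → UpgradeSplits C u n (b * 0) r
  u-split-below-min {n} {b} {r} n-base r<b n≡ =
      trans (cong u n≡r) (sym (cong (_+ u r) u[b*0]≡0))
    , proj₁ min-C
    , IsBase-C-below-minB (<⇒≤ (subst (_< mB) (sym (u-below-min n<mB)) n<mB))
    , IsBase-C-below-minB (subst (_≤ mB) (sym u[b*0]≡0) z≤n)
    where
    n≡r : n ≡ r
    n≡r = trans n≡ (cong (_+ r) (*-zeroʳ b))
    n<mB : n < mB
    n<mB = below-base⇒below-min n-base (subst (_< b) (sym n≡r) r<b)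
    u[b*0]≡0 : u (b * 0) ≡ 0
    u[b*0]≡0 = trans (cong u (*-zeroʳ b)) u0≡0

  u-split : ∀ {n b} a {r} → IsBase B n b → r < b → n ≡ b * a + r → UpgradeSplits C u n (b * a) r
  u-split zero n-base r<b n≡ = u-split-below-min n-base r<b n≡
  u-split {n} {b} (suc a) {r} n-base r<b n≡ =
    case chosen (≤-trans (proj₂ isMinB b (proj₁ (proj₂ (proj₂ n-base)))) b≤m) (IsBase-between n-base b≤m m≤n)
    of λ where
      (γ , (Cγ , Dm , _ , s , succ , u[m]<s) , _) →
        Block.u-split n-base b≤m (m∣m*n (suc a)) m≤n Cγ Dm succ u[m]<s r<b n≡
    where
    b≤m : b ≤ b * suc a
    b≤m = m≤m*n b (suc a)
    m≤n : b * suc a ≤ n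
    m≤n = subst (b * suc a ≤_) (sym n≡) (m≤m+n (b * suc a) r)

lemma3p3 : (B C : Subset) (u : ℕ → ℕ) → GoodSuccessor B C u →
    (n b : ℕ) → IsBase B n b →
    (a r : ℕ) → r < b → n ≡ b * a + r →
    (c : ℕ) → u b ≤ c →
    (Σ ℕ λ v → DBC u b c (b * a) v × DBC u b c n (v + u r))
    × (u n ≡ u (b * a) + u r)
    × (Σ ℕ λ d → IsBase C (u n) d × IsBase C (u (b * a)) d)
lemma3p3 B C u (hB , hC , minB≤minC , upgrade , _) n b n-base@(_ , isMinB , Bb , _) a r r<b n≡ c _ =
  DBC-split u0≡0 r<b n≡ , u-split a n-base r<b n≡
  where
  open Upgrade hB hC minB≤minC upgrade isMinB
  open DeepBaseChange u (1<B Bb) c
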